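{- Let $G$ be a 2-connected outerplanar graph with at least 4 vertices, and let $v$ be a vertex of $G$. If $G$ is not a cycle, then $G$ contains an ear, or an ear chain, or an ear double chain that is good for $v$.
   Context: All graphs are simple and finite; $d_G(x)$ denotes the degree of $x$ in $G$. Let $G$ be a 2-connected outerplanar graph and $v$ a vertex of $G$. An ear $H$ of $G$ is a cycle $(u_1,u_2,\dots,u_r)$ in $G$ such that $d_G(u_i)=2$ for all $i\in\{2,\dots,r-1\}$; the edge $u_1u_r$ is its root edge. $H$ is good for $v$ if there exists $i\in\{1,r\}$ such that $d_G(u_i)=3$ and $v\notin V(H)\setminus\{u_{r+1-i}\}$. An ear chain $H$ is a sequence of ears $H_1,\dots,H_{s-1}$ ($s\ge 3$) whose root edges together with the edge $v_1v_s$ form a cycle $(v_1,v_2,\dots,v_s)$ of $G$, where the root edge of $H_i$ is $v_iv_{i+1}$, and $d_G(v_i)=4$ for all $i\in\{2,\dots,s-1\}$; $V(H)$ is the union of the vertex sets of the $H_i$, and $v_1v_s$ is the root edge of $H$. $H$ is good for $v$ if there exists $i\in\{1,s\}$ such that $d_G(v_i)\le 5$ and $v\notin V(H)\setminus\{v_{s+1-i}\}$. An ear double chain $H$ is a sequence of ear chains $H_1,\dots,H_{t-1}$ ($t\ge 3$) whose root edges together with the edge $w_1w_t$ form a cycle $(w_1,\dots,w_t)$ of $G$, where the root edge of $H_i$ is $w_iw_{i+1}$, and $d_G(w_i)=6$ for all $i\in\{2,\dots,t-1\}$; $V(H)$ is the union of the vertex sets of the $H_i$, and $w_1w_t$ is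 the root edge of $H$. $H$ is good for $v$ if $v\notin V(H)\setminus\{w_1,w_t\}$. -}

module Defs where

open import Data.Nat using (ℕ; _≤_; _+_)
open import Data.Bool using (Bool; true; false; if_then_else_)
open import Data.Fin using (Fin; _<_)
open import Data.List using (List; []; _∷_; _++_; [_]; length; map; allFin; concatMap)
open import Data.Nat.ListAction using (sum)
open import Data.List.Membership.Propositional using (_∈_)
open import Data.List.Relation.Unary.All using (All)
open import Data.List.Relation.Unary.Linked using (Linked)
open import Data.List.Relation.Unary.Unique.Propositional using (Unique)
open import Data.Product using (Σ; _×_)
open import Data.Sum using (_⊎_)
open import Data.Unit using (⊤)
open import Data.Empty using (⊥)
open import Function.Definitions using (Injective)
open import Relation.Binary.PropositionalEquality using (_≡_; _≢_)
open import Relation.Nullary using (¬_)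

record Graph (n : ℕ) : Set where
  field
    adj    : Fin n → Fin n → Bool
    sym    : ∀ x y → adj x y ≡ adj y x
    irrefl : ∀ x → adj x x ≡ false

module _ {n : ℕ} (G : Graph n) where
  open Graph G

  E : Fin n → Fin n → Set
  E x y = adj x y ≡ true

  deg : Fin n → ℕ
  deg x = sum (map (λ y → if adj x y then 1 else 0) (allFin n))

  data Reach (ok : Fin n → Set) : Fin n → Fin n → Set where
    here : ∀ {u} → ok u → Reach ok u u
    step : ∀ {u x w} → ok u → E u x → Reach ok x w → Reach ok u w

  Connected : Set
  Connected = ∀ u w → Reach (λ _ → ⊤) u w

  TwoConnected : Set
  TwoConnected = 3 ≤ n × Connected
    × (∀ x u w → u ≢ x → w ≢ x → Reach (λ y → y ≢ x) u w)

  -- outerplanar: the vertices can be placed in convex position (on a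
  -- circle, in the cyclic order given by the injective map σ) such that
  -- no two edges, drawn as straight chords, cross.
  Outerplanar : Set
  Outerplanar = Σ (Fin n → Fin n) λ σ → Injective _≡_ _≡_ σ ×
    (∀ a b c d → E a b → E c d →
       ¬ (σ a < σ c × σ c < σ b × σ b < σ d))

  IsCycleGraph : Set
  IsCycleGraph = Connected × (∀ x → deg x ≡ 2)

  CycleThrough : Fin n → List (Fin n) → Fin n → Set
  CycleThrough a mid b =
    1 ≤ length mid × Unique (a ∷ mid ++ [ b ])
    × Linked E (a ∷ mid ++ [ b ]) × E b a

  -- consecutive objects of a sequence have root edges x_i x_{i+1}
  Links : {A : Set} → (A → Fin n) → (A → Fin n) → List (Fin n) → List A → Set
  Links s t (x ∷ y ∷ xs) (h ∷ hs) = s h ≡ x × t h ≡ y × Links s t (y ∷ xs) hs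
  Links s t (x ∷ []) [] = ⊤
  Links s t _ _ = ⊥

  -- Ear (u₁ = first, u₂ … u_{r-1} = mid, u_r = last); root edge first–last
  record Ear : Set where
    field
      first last : Fin n
      mid        : List (Fin n)
      cycle      : CycleThrough first mid last
      deg2       : All (λ x → deg x ≡ 2) mid

  earVerts : Ear → List (Fin n)
  earVerts H = Ear.first H ∷ Ear.mid H ++ [ Ear.last H ]

  GoodEar : Fin n → Ear → Set
  GoodEar v H =
      (deg (Ear.first H) ≡ 3 × (v ∈ earVerts H → v ≡ Ear.last H))
    ⊎ (deg (Ear.last H) ≡ 3 × (v ∈ earVerts H → v ≡ Ear.first H))

  -- Ear chain: cycle (v₁ = first, v₂ … v_{s-1} = inner, v_s = last),
  -- ears H₁ … H_{s-1}, H_i with root edge v_i v_{i+1}; root edge v₁v_s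
  record EarChain : Set where
    field
      first last : Fin n
      inner      : List (Fin n)
      cycle      : CycleThrough first inner last
      deg4       : All (λ x → deg x ≡ 4) inner
      ears       : List Ear
      links      : Links Ear.first Ear.last (first ∷ inner ++ [ last ]) ears

  chainVerts : EarChain → List (Fin n)
  chainVerts C = concatMap earVerts (EarChain.ears C)

  GoodChain : Fin n → EarChain → Set
  GoodChain v C =
      (deg (EarChain.first C) ≤ 5 × (v ∈ chainVerts C → v ≡ EarChain.last C))
    ⊎ (deg (EarChain.last C) ≤ 5 × (v ∈ chainVerts C → v ≡ EarChain.first C))

  -- Ear double chain: cycle (w₁ = first, w₂ … w_{t-1} = inner, w_t = last),
  -- ear chains H₁ … H_{t-1}, H_i with root edge w_i w_{i+1}
  record EarDoubleChain : Set where
    field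
      first last : Fin n
      inner      : List (Fin n)
      cycle      : CycleThrough first inner last
      deg6       : All (λ x → deg x ≡ 6) inner
      chains     : List EarChain
      links      : Links EarChain.first EarChain.last (first ∷ inner ++ [ last ]) chains

  doubleVerts : EarDoubleChain → List (Fin n)
  doubleVerts D = concatMap chainVerts (EarDoubleChain.chains D)

  GoodDouble : Fin n → EarDoubleChain → Set
  GoodDouble v D = v ∈ doubleVerts D →
    v ≡ EarDoubleChain.first D ⊎ v ≡ EarDoubleChain.last D

-- Number the vertices 0 … N along the outer face, starting at v; 2-connectivity
-- makes consecutive positions, and 0 and N, adjacent.  Every edge cd with c < d
-- cuts off the part of G on positions c … d.  By induction on d − c, walking the
-- face inside cd: if two consecutive regions along the face have different shapes,
-- the vertex between them has degree 3, 4 or 5 and one of them is a good ear or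
-- chain; otherwise the regions are all edges, all ears or all ear chains, and the
-- face forms an ear, an ear chain or a good ear double chain rooted at cd.  For the
-- edge 0N the ear case makes G a cycle, and the ear-chain case leaves a good ear
-- ending at N.

module Submission where

open import Defs
open import Data.Bool using (if_then_else_; true; false)
import Data.Bool.Properties as Boolₚ
open import Data.Empty using (⊥; ⊥-elim)
open import Data.Fin as Fin using (Fin; toℕ; fromℕ<)
import Data.Fin.Properties as Finₚ
import Data.Fin.Permutation as Perm
open import Data.List using (List; []; _∷_; _++_; [_]; map; allFin; tabulate; concatMap; length)
import Data.List.Properties as Listₚ
open import Data.List.Membership.Propositional using (_∈_; _∉_)
open import Data.List.Relation.Unary.All as All using (All; []; _∷_)
import Data.List.Relation.Unary.All.Properties as Allₚ
open import Data.List.Relation.Unary.AllPairs using (AllPairs; []; _∷_)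
open import Data.List.Relation.Unary.Linked using (Linked; [-]; _∷_)
import Data.List.Relation.Unary.Linked.Properties as Linkedₚ
open import Data.List.Relation.Unary.Unique.Propositional using (Unique)
open import Data.Nat using (ℕ; zero; suc; _≤_; _<_; _+_; _∸_; z≤n; s≤s)
open import Data.Nat.DivMod using (_mod_; m<n⇒m%n≡m)
open import Data.Nat.ListAction using (sum)
open import Data.Nat.Properties
import Algebra.Properties.CommutativeMonoid.Sum +-0-commutativeMonoid as Sum
open import Data.Product using (Σ; _×_; _,_; proj₁; proj₂)
open import Data.Sum using (_⊎_; inj₁; inj₂; map₂)
open import Data.Unit using (⊤; tt)
open import Function.Definitions using (Injective; StrictlySurjective)
open import Relation.Binary.Definitions using (tri<; tri≈; tri>)
open import Relation.Binary.PropositionalEquality hiding ([_])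
open import Relation.Nullary using (¬_; Dec; yes; no)
open import Relation.Nullary.Decidable using (_×-dec_; _→-dec_)

injective⇒strictlySurjective : ∀ {n} (f : Fin n → Fin n) → Injective _≡_ _≡_ f →
  StrictlySurjective _≡_ f
injective⇒strictlySurjective {suc n} f f-inj k with Finₚ.any? (λ j → f j Finₚ.≟ k)
... | yes hit = hit
... | no miss = ⊥-elim (1+n≰n (Finₚ.injective⇒≤ g-inj))
  where
  g : Fin (suc n) → Fin n
  g j = Fin.punchOut (λ k≡fj → miss (j , sym k≡fj))
  g-inj : Injective _≡_ _≡_ g
  g-inj {x} {y} eq = f-inj (Finₚ.punchOut-injective {i = k} (λ e → miss (x , sym e)) (λ e → miss (y , sym e)) eq)

-- π t is the vertex at position t; it is junk for t ≥ n.
record Enumeration (n : ℕ) : Set where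
  field
    pos   : Fin n → ℕ
    π     : ℕ → Fin n
    pos<n : ∀ x → pos x < n
    π-pos : ∀ x → π (pos x) ≡ x
    pos-π : ∀ {t} → t < n → pos (π t) ≡ t

injection⇒enumeration : ∀ {N} (pos : Fin (suc N) → ℕ) → (∀ x → pos x < suc N) →
  (∀ {x y} → pos x ≡ pos y → x ≡ y) → Enumeration (suc N)
injection⇒enumeration {N} pos pos<n pos-inj = record
  { pos = pos ; π = π ; pos<n = pos<n ; π-pos = π-pos ; pos-π = pos-π }
  where
  posF : Fin (suc N) → Fin (suc N)
  posF x = fromℕ< (pos<n x)

  toℕ-posF : ∀ x → toℕ (posF x) ≡ pos x
  toℕ-posF x = Finₚ.toℕ-fromℕ< (pos<n x)

  posF-inj : Injective _≡_ _≡_ posF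
  posF-inj {x} {y} eq = pos-inj (trans (sym (toℕ-posF x)) (trans (cong toℕ eq) (toℕ-posF y)))

  posF-onto : StrictlySurjective _≡_ posF
  posF-onto = injective⇒strictlySurjective posF posF-inj

  π : ℕ → Fin (suc N)
  π t = proj₁ (posF-onto (t mod suc N))

  toℕ-mod : ∀ {t} → t < suc N → toℕ (t mod suc N) ≡ t
  toℕ-mod t<n = trans (Finₚ.toℕ-fromℕ< _) (m<n⇒m%n≡m t<n)

  pos-π : ∀ {t} → t < suc N → pos (π t) ≡ t
  pos-π {t} t<n = begin
    pos (π t)              ≡⟨ toℕ-posF (π t) ⟨
    toℕ (posF (π t))       ≡⟨ cong toℕ (proj₂ (posF-onto (t mod suc N))) ⟩
    toℕ (t mod suc N)      ≡⟨ toℕ-mod t<n ⟩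
    t ∎
    where open ≡-Reasoning

  π-pos : ∀ x → π (pos x) ≡ x
  π-pos x = pos-inj (pos-π (pos<n x))

sumFrom : (ℕ → ℕ) → ℕ → ℕ → ℕ
sumFrom f lo zero    = 0
sumFrom f lo (suc k) = f lo + sumFrom f (suc lo) k

sumRange : (ℕ → ℕ) → ℕ → ℕ → ℕ
sumRange f lo hi = sumFrom f lo (hi ∸ lo)

sumFrom-+ : ∀ f lo k l → sumFrom f lo (k + l) ≡ sumFrom f lo k + sumFrom f (lo + k) l
sumFrom-+ f lo zero    l = cong (λ m → sumFrom f m l) (sym (+-identityʳ lo))
sumFrom-+ f lo (suc k) l = begin
  f lo + sumFrom f (suc lo) (k + l)
    ≡⟨ cong (f lo +_) (sumFrom-+ f (suc lo) k l) ⟩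
  f lo + (sumFrom f (suc lo) k + sumFrom f (suc lo + k) l)
    ≡⟨ +-assoc (f lo) _ _ ⟨
  f lo + sumFrom f (suc lo) k + sumFrom f (suc lo + k) l
    ≡⟨ cong (λ m → f lo + sumFrom f (suc lo) k + sumFrom f m l) (+-suc lo k) ⟨
  f lo + sumFrom f (suc lo) k + sumFrom f (lo + suc k) l ∎
  where open ≡-Reasoning

sumFrom-zero : ∀ f lo k → (∀ t → lo ≤ t → t < lo + k → f t ≡ 0) → sumFrom f lo k ≡ 0
sumFrom-zero f lo zero    f≡0 = refl
sumFrom-zero f lo (suc k) f≡0 = cong₂ _+_
  (f≡0 lo ≤-refl (subst (lo <_) (sym (+-suc lo k)) (s≤s (m≤m+n lo k))))
  (sumFrom-zero f (suc lo) k λ t lo<t t<hi →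
    f≡0 t (<⇒≤ lo<t) (subst (t <_) (sym (+-suc lo k)) t<hi))

sumRange-split : ∀ f {lo m hi} → lo ≤ m → m ≤ hi → sumRange f lo hi ≡ sumRange f lo m + sumRange f m hi
sumRange-split f {lo} {m} {hi} lo≤m m≤hi = begin
  sumFrom f lo (hi ∸ lo)
    ≡⟨ cong (sumFrom f lo) hi∸lo ⟩
  sumFrom f lo ((m ∸ lo) + (hi ∸ m))
    ≡⟨ sumFrom-+ f lo (m ∸ lo) (hi ∸ m) ⟩
  sumFrom f lo (m ∸ lo) + sumFrom f (lo + (m ∸ lo)) (hi ∸ m)
    ≡⟨ cong (λ k → sumFrom f lo (m ∸ lo) + sumFrom f k (hi ∸ m)) (m+[n∸m]≡n lo≤m) ⟩
  sumFrom f lo (m ∸ lo) + sumFrom f m (hi ∸ m) ∎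
  where
  open ≡-Reasoning
  hi∸lo : hi ∸ lo ≡ (m ∸ lo) + (hi ∸ m)
  hi∸lo = trans (cong (_∸ lo) (sym (m+[n∸m]≡n m≤hi))) (+-∸-comm (hi ∸ m) lo≤m)

sumRange-zero : ∀ f {lo hi} → lo ≤ hi → (∀ t → lo ≤ t → t < hi → f t ≡ 0) → sumRange f lo hi ≡ 0
sumRange-zero f {lo} {hi} lo≤hi f≡0 =
  sumFrom-zero f lo (hi ∸ lo) λ t lo≤t t<hi → f≡0 t lo≤t (subst (t <_) (m+[n∸m]≡n lo≤hi) t<hi)

sumRange-singleton : ∀ f t → sumRange f t (suc t) ≡ f t
sumRange-singleton f t rewrite m+n∸n≡m 1 t = +-identityʳ (f t)

sum≡sumFrom : ∀ {n} (h : Fin n → ℕ) f lo → (∀ i → h i ≡ f (lo + toℕ i)) → Sum.sum h ≡ sumFrom f lo n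
sum≡sumFrom {zero}  h f lo h≗f = refl
sum≡sumFrom {suc n} h f lo h≗f = cong₂ _+_ (trans (h≗f Fin.zero) (cong f (+-identityʳ lo)))
  (sum≡sumFrom (λ i → h (Fin.suc i)) f (suc lo) λ i → trans (h≗f (Fin.suc i)) (cong f (+-suc lo (toℕ i))))

sum-tabulate : ∀ {n} (h : Fin n → ℕ) → sum (tabulate h) ≡ Sum.sum h
sum-tabulate {zero}  h = refl
sum-tabulate {suc n} h = cong (h Fin.zero +_) (sum-tabulate (λ i → h (Fin.suc i)))

sum-allFin : ∀ {n} (h : Fin n → ℕ) → sum (map h (allFin n)) ≡ Sum.sum h
sum-allFin h = trans (cong sum (Listₚ.map-tabulate (λ i → i) h)) (sum-tabulate h)

sum-allFin≡sumRange : ∀ {n} (e : Enumeration n) (h : Fin n → ℕ) →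
  sum (map h (allFin n)) ≡ sumRange (λ t → h (Enumeration.π e t)) 0 n
sum-allFin≡sumRange {n} e h = begin
  sum (map h (allFin n))        ≡⟨ sum-allFin h ⟩
  Sum.sum h                     ≡⟨ Sum.sum-permute h (Perm.permutation vertexAt posF vertexAt-posF posF-vertexAt) ⟩
  Sum.sum (λ i → h (vertexAt i)) ≡⟨ sum≡sumFrom (λ i → h (vertexAt i)) (λ t → h (π t)) 0 (λ i → refl) ⟩
  sumRange (λ t → h (π t)) 0 n  ∎
  where
  open ≡-Reasoning
  open Enumeration e
  vertexAt : Fin n → Fin n
  vertexAt i = π (toℕ i)
  posF : Fin n → Fin n
  posF x = fromℕ< (pos<n x)
  vertexAt-posF : ∀ x → vertexAt (posF x) ≡ x
  vertexAt-posF x = trans (cong π (Finₚ.toℕ-fromℕ< (pos<n x))) (π-pos x)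
  posF-vertexAt : ∀ i → posF (vertexAt i) ≡ i
  posF-vertexAt i = Finₚ.toℕ-injective (trans (Finₚ.toℕ-fromℕ< _) (pos-π (Finₚ.toℕ<n i)))

Ascending : ℕ → ℕ → ℕ → ℕ → Set
Ascending w x y z = w < x × x < y × y < z

module Rotation {n : ℕ} (r : Fin n) where

  private
    ρ : ℕ
    ρ = toℕ r

    shift : (s : ℕ) → Dec (ρ ≤ s) → ℕ
    shift s (yes _) = s ∸ ρ
    shift s (no  _) = s + (n ∸ ρ)

  rotate : Fin n → ℕ
  rotate s = shift (toℕ s) (ρ ≤? toℕ s)

  data RotateView (s : Fin n) : Set where
    upper : ρ ≤ toℕ s → toℕ s ≡ ρ + rotate s → RotateView s
    lower : toℕ s < ρ → rotate s ≡ toℕ s + (n ∸ ρ) → RotateView s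

  rotateView : ∀ s → RotateView s
  rotateView s = view (ρ ≤? toℕ s) refl
    where
    view : (d : Dec (ρ ≤ toℕ s)) → rotate s ≡ shift (toℕ s) d → RotateView s
    view (yes ρ≤s) eq = upper ρ≤s (trans (sym (m+[n∸m]≡n ρ≤s)) (cong (ρ +_) (sym eq)))
    view (no  ρ≰s) eq = lower (≰⇒> ρ≰s) eq

  private
    ρ+[n∸ρ]≡n : ρ + (n ∸ ρ) ≡ n
    ρ+[n∸ρ]≡n = m+[n∸m]≡n (<⇒≤ (Finₚ.toℕ<n r))

    upper-rotate< : ∀ {s} → toℕ s ≡ ρ + rotate s → rotate s < n ∸ ρ
    upper-rotate< {s} eq = +-cancelˡ-< ρ _ _ (subst₂ _<_ eq (sym ρ+[n∸ρ]≡n) (Finₚ.toℕ<n s))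

    lower-rotate≥ : ∀ {s} → rotate s ≡ toℕ s + (n ∸ ρ) → n ∸ ρ ≤ rotate s
    lower-rotate≥ {s} eq = subst (n ∸ ρ ≤_) (sym eq) (m≤n+m (n ∸ ρ) (toℕ s))

  rotate<n : ∀ s → rotate s < n
  rotate<n s with rotateView s
  ... | upper _ eq = <-≤-trans (upper-rotate< eq) (m∸n≤m n ρ)
  ... | lower s<ρ eq = subst (_< n) (sym eq) (subst (toℕ s + (n ∸ ρ) <_) ρ+[n∸ρ]≡n (+-monoˡ-< (n ∸ ρ) s<ρ))

  rotate-r : rotate r ≡ 0
  rotate-r with rotateView r
  ... | upper _ eq = +-cancelˡ-≡ ρ _ _ (trans (sym eq) (sym (+-identityʳ ρ)))
  ... | lower ρ<ρ _ = ⊥-elim (<-irrefl refl ρ<ρ)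

  rotate-injective : ∀ {s s′} → rotate s ≡ rotate s′ → s ≡ s′
  rotate-injective {s} {s′} eq with rotateView s | rotateView s′
  ... | upper _ e | upper _ e′ = Finₚ.toℕ-injective (trans e (trans (cong (ρ +_) eq) (sym e′)))
  ... | lower _ e | lower _ e′ = Finₚ.toℕ-injective (+-cancelʳ-≡ (n ∸ ρ) _ _ (trans (sym e) (trans eq e′)))
  ... | upper _ e | lower _ e′ = ⊥-elim (<⇒≱ (upper-rotate< e) (subst (n ∸ ρ ≤_) (sym eq) (lower-rotate≥ e′)))
  ... | lower _ e | upper _ e′ = ⊥-elim (<⇒≱ (upper-rotate< e′) (subst (n ∸ ρ ≤_) eq (lower-rotate≥ e)))

  private
    upper-< : ∀ {s s′} → toℕ s ≡ ρ + rotate s → toℕ s′ ≡ ρ + rotate s′ → rotate s < rotate s′ → toℕ s < toℕ s′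
    upper-< e e′ lt = subst₂ _<_ (sym e) (sym e′) (+-monoʳ-< ρ lt)

    lower-< : ∀ {s s′} → rotate s ≡ toℕ s + (n ∸ ρ) → rotate s′ ≡ toℕ s′ + (n ∸ ρ) → rotate s < rotate s′ → toℕ s < toℕ s′
    lower-< e e′ lt = +-cancelʳ-< (n ∸ ρ) _ _ (subst₂ _<_ e e′ lt)

    lower-upper : ∀ {s s′} → rotate s ≡ toℕ s + (n ∸ ρ) → toℕ s′ ≡ ρ + rotate s′ → rotate s < rotate s′ → ⊥
    lower-upper e e′ lt = <⇒≱ (<-trans lt (upper-rotate< e′)) (lower-rotate≥ e)

  -- The positions that wrap around come first in the original order,
  -- so the original order is a cyclic shift of the rotated one.
  rotate-ascending : ∀ {w x y z} → Ascending (rotate w) (rotate x) (rotate y) (rotate z) →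
    let asc = λ a b c d → Ascending (toℕ a) (toℕ b) (toℕ c) (toℕ d) in
    asc w x y z ⊎ asc x y z w ⊎ asc y z w x ⊎ asc z w x y
  rotate-ascending {w} {x} {y} {z} (wx , xy , yz)
    with rotateView w | rotateView x | rotateView y | rotateView z
  ... | upper _ ew | upper _ ex | upper _ ey | upper _ ez =
    inj₁ (upper-< ew ex wx , upper-< ex ey xy , upper-< ey ez yz)
  ... | lower _ ew | lower _ ex | lower _ ey | lower _ ez =
    inj₁ (lower-< ew ex wx , lower-< ex ey xy , lower-< ey ez yz)
  ... | upper ρ≤w ew | upper _ ex | upper _ ey | lower z<ρ ez =
    inj₂ (inj₂ (inj₂ (<-≤-trans z<ρ ρ≤w , upper-< ew ex wx , upper-< ex ey xy)))
  ... | upper ρ≤w ew | upper _ ex | lower _ ey | lower z<ρ ez =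
    inj₂ (inj₂ (inj₁ (lower-< ey ez yz , <-≤-trans z<ρ ρ≤w , upper-< ew ex wx)))
  ... | upper ρ≤w ew | lower _ ex | lower _ ey | lower z<ρ ez =
    inj₂ (inj₁ (lower-< ex ey xy , lower-< ey ez yz , <-≤-trans z<ρ ρ≤w))
  ... | lower _ ew | upper _ ex | _ | _ = ⊥-elim (lower-upper ew ex wx)
  ... | _ | lower _ ex | upper _ ey | _ = ⊥-elim (lower-upper ex ey xy)
  ... | _ | _ | lower _ ey | upper _ ez = ⊥-elim (lower-upper ey ez yz)

record Greatest (P : ℕ → Set) (lo hi : ℕ) : Set where
  constructor greatest
  field
    value   : ℕ
    lo≤     : lo ≤ value
    ≤hi     : value ≤ hi
    holds   : P value
    maximal : ∀ {s} → value < s → s ≤ hi → ¬ P s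

record Least (P : ℕ → Set) (lo hi : ℕ) : Set where
  constructor least
  field
    value   : ℕ
    lo≤     : lo ≤ value
    ≤hi     : value ≤ hi
    holds   : P value
    minimal : ∀ {s} → lo ≤ s → s < value → ¬ P s

NoneBetween : (ℕ → Set) → ℕ → ℕ → Set
NoneBetween P lo hi = ∀ {s} → lo ≤ s → s ≤ hi → ¬ P s

module _ {P : ℕ → Set} (P? : ∀ t → Dec (P t)) where

  private
    endpoint? : ∀ lo hi → Dec (lo ≤ hi × P hi)
    endpoint? lo hi = (lo ≤? hi) ×-dec P? hi

    none-zero : ∀ {lo} → ¬ (lo ≤ 0 × P 0) → NoneBetween P lo 0
    none-zero ¬end lo≤s z≤n p = ¬end (lo≤s , p)

    none-suc : ∀ {lo h} → ¬ (lo ≤ suc h × P (suc h)) → NoneBetween P lo h → NoneBetween P lo (suc h)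
    none-suc ¬end none lo≤s s≤h+1 p with m≤n⇒m<n∨m≡n s≤h+1
    ... | inj₁ s≤h  = none lo≤s (≤-pred s≤h) p
    ... | inj₂ refl = ¬end (lo≤s , p)

  greatest? : ∀ lo hi → Greatest P lo hi ⊎ NoneBetween P lo hi
  greatest? lo hi with endpoint? lo hi
  ... | yes (lo≤hi , p) = inj₁ (greatest hi lo≤hi ≤-refl p λ hi<s s≤hi → ⊥-elim (<⇒≱ hi<s s≤hi))
  greatest? lo zero    | no ¬end = inj₂ (none-zero ¬end)
  greatest? lo (suc h) | no ¬end with greatest? lo h
  ... | inj₂ none = inj₂ (none-suc ¬end none)
  ... | inj₁ (greatest t lo≤t t≤h p max) = inj₁ (greatest t lo≤t (m≤n⇒m≤1+n t≤h) p max′)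
    where
    max′ : ∀ {s} → t < s → s ≤ suc h → ¬ P s
    max′ t<s s≤h+1 with m≤n⇒m<n∨m≡n s≤h+1
    ... | inj₁ s≤h  = max t<s (≤-pred s≤h)
    ... | inj₂ refl = λ q → ¬end (≤-trans lo≤t (<⇒≤ t<s) , q)

  least? : ∀ lo hi → Least P lo hi ⊎ NoneBetween P lo hi
  least? lo zero with endpoint? lo zero
  ... | yes (lo≤0 , p) = inj₁ (least 0 lo≤0 ≤-refl p λ _ ())
  ... | no ¬end        = inj₂ (none-zero ¬end)
  least? lo (suc h) with least? lo h
  ... | inj₁ (least t lo≤t t≤h p min) = inj₁ (least t lo≤t (m≤n⇒m≤1+n t≤h) p min)
  ... | inj₂ none with endpoint? lo (suc h)
  ...   | yes (lo≤h+1 , p) = inj₁ (least (suc h) lo≤h+1 ≤-refl p λ lo≤s s≤h → none lo≤s (≤-pred s≤h))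
  ...   | no ¬end          = inj₂ (none-suc ¬end none)

  someBetween? : ∀ lo hi → Dec (Σ ℕ λ s → lo ≤ s × s ≤ hi × P s)
  someBetween? lo hi with greatest? lo hi
  ... | inj₁ (greatest t lo≤t t≤hi p _) = yes (t , lo≤t , t≤hi , p)
  ... | inj₂ none = no λ (s , lo≤s , s≤hi , p) → none lo≤s s≤hi p

Linked<⇒bounded : ∀ {a b} xs → Linked _<_ (a ∷ xs ++ [ b ]) → All (λ t → a ≤ t × t ≤ b) (a ∷ xs ++ [ b ])
Linked<⇒bounded []       (a<b ∷ [-]) = (≤-refl , <⇒≤ a<b) ∷ (<⇒≤ a<b , ≤-refl) ∷ []
Linked<⇒bounded (x ∷ xs) (a<x ∷ sorted) with Linked<⇒bounded xs sorted
... | bounds@((_ , x≤b) ∷ _) =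
  (≤-refl , ≤-trans (<⇒≤ a<x) x≤b) ∷ All.map (λ (x≤t , t≤b) → ≤-trans (<⇒≤ a<x) x≤t , t≤b) bounds

GoodStructure : ∀ {n} → Graph n → Fin n → Set
GoodStructure G v = Σ (Ear G) (GoodEar G v) ⊎ Σ (EarChain G) (GoodChain G v) ⊎ Σ (EarDoubleChain G) (GoodDouble G v)

module _ {n : ℕ} (G : Graph n) where

  E-sym : ∀ {x y} → E G x y → E G y x
  E-sym {x} {y} e = trans (Graph.sym G y x) e

  Reach-source : ∀ {ok u w} → Reach G ok u w → ok u
  Reach-source (here ok-u)     = ok-u
  Reach-source (step ok-u _ _) = ok-u

  Reach-closed : ∀ {ok} (P : Fin n → Set) → (∀ {y z} → P y → E G y z → ok z → P z) →
    ∀ {u w} → Reach G ok u w → P u → P w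
  Reach-closed P closed (here _)       Pu = Pu
  Reach-closed P closed (step _ e rest) Pu = Reach-closed P closed rest (closed Pu e (Reach-source rest))

record Layout {n : ℕ} (G : Graph n) (v : Fin n) : Set where
  field
    enumeration : Enumeration n
  open Enumeration enumeration public
  field
    pos-v      : pos v ≡ 0
    noCrossing : ∀ {i j k l} → Ascending i j k l → l < n → E G (π i) (π k) → E G (π j) (π l) → ⊥

outerplanar⇒layout : ∀ {N} (G : Graph (suc N)) → Outerplanar G → ∀ v → Layout G v
outerplanar⇒layout {N} G (σ , σ-inj , σ-noCrossing) v = record
  { enumeration = enumeration ; pos-v = rotate-r ; noCrossing = noCrossing }
  where
  open Rotation (σ v)
  enumeration : Enumeration (suc N)
  enumeration = injection⇒enumeration (λ x → rotate (σ x)) (λ x → rotate<n (σ x))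
    (λ eq → σ-inj (rotate-injective eq))
  open Enumeration enumeration

  ascending-pos : ∀ {i j k l} → Ascending i j k l → l < suc N →
    Ascending (pos (π i)) (pos (π j)) (pos (π k)) (pos (π l))
  ascending-pos {i} {j} {k} (i<j , j<k , k<l) l<n =
    subst₂ _<_ (sym (pos-π i<n)) (sym (pos-π j<n)) i<j ,
    subst₂ _<_ (sym (pos-π j<n)) (sym (pos-π k<n)) j<k ,
    subst₂ _<_ (sym (pos-π k<n)) (sym (pos-π l<n)) k<l
    where
    k<n : k < suc N
    k<n = <-trans k<l l<n
    j<n : j < suc N
    j<n = <-trans j<k k<n
    i<n : i < suc N
    i<n = <-trans i<j j<n

  noCrossing : ∀ {i j k l} → Ascending i j k l → l < suc N → E G (π i) (π k) → E G (π j) (π l) → ⊥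
  noCrossing asc l<n eik ejl with rotate-ascending (ascending-pos asc l<n)
  ... | inj₁ asc′               = σ-noCrossing _ _ _ _ eik ejl asc′
  ... | inj₂ (inj₁ asc′)        = σ-noCrossing _ _ _ _ ejl (E-sym G eik) asc′
  ... | inj₂ (inj₂ (inj₁ asc′)) = σ-noCrossing _ _ _ _ (E-sym G eik) (E-sym G ejl) asc′
  ... | inj₂ (inj₂ (inj₂ asc′)) = σ-noCrossing _ _ _ _ (E-sym G ejl) eik asc′

module Positions {N : ℕ} {G : Graph (suc N)} {v : Fin (suc N)} (L : Layout G v) where
  open Layout L public

  n : ℕ
  n = suc N

  infix 4 _~_ _~?_
  _~_ : ℕ → ℕ → Set
  s ~ t = E G (π s) (π t)

  _~?_ : ∀ s t → Dec (s ~ t)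
  s ~? t = Graph.adj G (π s) (π t) Boolₚ.≟ true

  ~-sym : ∀ {s t} → s ~ t → t ~ s
  ~-sym = E-sym G

  ~-irrefl : ∀ {t} → ¬ t ~ t
  ~-irrefl {t} t~t with trans (sym (Graph.irrefl G (π t))) t~t
  ... | ()

  π-injective : ∀ {s t} → s < n → t < n → π s ≡ π t → s ≡ t
  π-injective s<n t<n eq = trans (sym (pos-π s<n)) (trans (cong pos eq) (pos-π t<n))

  neighbours : ℕ → ℕ → ℕ → ℕ
  neighbours x = sumRange (λ t → if Graph.adj G (π x) (π t) then 1 else 0)

  neighbours-split : ∀ x {lo m hi} → lo ≤ m → m ≤ hi → neighbours x lo hi ≡ neighbours x lo m + neighbours x m hi
  neighbours-split x = sumRange-split _

  neighbours-none : ∀ x {lo hi} → lo ≤ hi → (∀ {t} → lo ≤ t → t < hi → ¬ x ~ t) → neighbours x lo hi ≡ 0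
  neighbours-none x lo≤hi none = sumRange-zero _ lo≤hi indicator≡0
    where
    indicator≡0 : ∀ t → _ ≤ t → t < _ → (if Graph.adj G (π x) (π t) then 1 else 0) ≡ 0
    indicator≡0 t lo≤t t<hi with Graph.adj G (π x) (π t) in eq
    ... | true  = ⊥-elim (none lo≤t t<hi eq)
    ... | false = refl

  neighbours-single : ∀ {x t} → x ~ t → neighbours x t (suc t) ≡ 1
  neighbours-single {x} {t} x~t = trans (sumRange-singleton _ t) (cong (λ b → if b then 1 else 0) x~t)

  neighbours-self : ∀ x → neighbours x x (suc x) ≡ 0
  neighbours-self x = neighbours-none x (n≤1+n x) λ x≤t t<x+1 x~t →
    ~-irrefl (subst (x ~_) (≤-antisym (≤-pred t<x+1) x≤t) x~t)

  deg≡neighbours : ∀ x → deg G (π x) ≡ neighbours x 0 n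
  deg≡neighbours x = sum-allFin≡sumRange enumeration _

  deg-within : ∀ {x p y} → p ≤ x → x < y → y < n →
    (∀ {t} → t < p → ¬ x ~ t) → (∀ {t} → y < t → t < n → ¬ x ~ t) →
    deg G (π x) ≡ neighbours x p x + neighbours x (suc x) (suc y)
  deg-within {x} {p} {y} p≤x x<y y<n below above = begin
    deg G (π x)
      ≡⟨ deg≡neighbours x ⟩
    neighbours x 0 n
      ≡⟨ neighbours-split x z≤n p≤n ⟩
    neighbours x 0 p + neighbours x p n
      ≡⟨ cong (_+ neighbours x p n) (neighbours-none x z≤n λ _ → below) ⟩
    neighbours x p n
      ≡⟨ neighbours-split x p≤x (<⇒≤ x<n) ⟩
    neighbours x p x + neighbours x x n
      ≡⟨ cong (neighbours x p x +_) (neighbours-split x (n≤1+n x) x<n) ⟩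
    neighbours x p x + (neighbours x x (suc x) + neighbours x (suc x) n)
      ≡⟨ cong (λ k → neighbours x p x + (k + neighbours x (suc x) n)) (neighbours-self x) ⟩
    neighbours x p x + neighbours x (suc x) n
      ≡⟨ cong (neighbours x p x +_) (neighbours-split x (s≤s (<⇒≤ x<y)) y<n) ⟩
    neighbours x p x + (neighbours x (suc x) (suc y) + neighbours x (suc y) n)
      ≡⟨ cong (λ k → neighbours x p x + (neighbours x (suc x) (suc y) + k)) (neighbours-none x y<n above) ⟩
    neighbours x p x + (neighbours x (suc x) (suc y) + 0)
      ≡⟨ cong (neighbours x p x +_) (+-identityʳ _) ⟩
    neighbours x p x + neighbours x (suc x) (suc y) ∎
    where
    open ≡-Reasoning
    x<n : x < n
    x<n = <-trans x<y y<n
    p≤n : p ≤ n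
    p≤n = ≤-trans p≤x (<⇒≤ x<n)

  module OuterCycle (2-connected : TwoConnected G) where

    private
      reach-closed : ∀ {ok} (Q : ℕ → Set) {u w} → u < n → w < n → Q u →
        (∀ {s t} → Q s → t < n → s ~ t → ok (π t) → Q t) → Reach G ok (π u) (π w) → Q w
      reach-closed {ok} Q {u} {w} u<n w<n Qu closed path =
        subst Q (pos-π w<n) (Reach-closed G (λ y → Q (pos y)) closed′ path (subst Q (sym (pos-π u<n)) Qu))
        where
        closed′ : ∀ {y z} → Q (pos y) → E G y z → ok z → Q (pos z)
        closed′ {y} {z} Qy e ok-z = closed Qy (pos<n z)
          (subst₂ (E G) (sym (π-pos y)) (sym (π-pos z)) e) (subst ok (sym (π-pos z)) ok-z)

    ¬separated : ∀ (Q : ℕ → Set) {u w} → u < n → w < n → Q u → ¬ Q w →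
      (∀ {s t} → Q s → t < n → s ~ t → Q t) → ⊥
    ¬separated Q u<n w<n Qu ¬Qw closed =
      ¬Qw (reach-closed Q u<n w<n Qu (λ Qs t<n s~t _ → closed Qs t<n s~t) (proj₁ (proj₂ 2-connected) _ _))

    ¬separatedBy : ∀ (Q : ℕ → Set) {c u w} → c < n → u < n → w < n → u ≢ c → w ≢ c → Q u → ¬ Q w →
      (∀ {s t} → Q s → t < n → s ~ t → t ≢ c → Q t) → ⊥
    ¬separatedBy Q c<n u<n w<n u≢c w≢c Qu ¬Qw closed =
      ¬Qw (reach-closed Q u<n w<n Qu (λ Qs t<n s~t πt≢πc → closed Qs t<n s~t (λ t≡c → πt≢πc (cong π t≡c)))
        (proj₂ (proj₂ 2-connected) _ _ _ (λ eq → u≢c (π-injective u<n c<n eq)) (λ eq → w≢c (π-injective w<n c<n eq))))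

    private
      NeighbourBeyond : ℕ → ℕ → Set
      NeighbourBeyond i x = Σ ℕ λ z → i < z × z ≤ N × x ~ z

      neighbourBeyond? : ∀ i x → Dec (NeighbourBeyond i x)
      neighbourBeyond? i x = someBetween? (x ~?_) (suc i) N

      lastCrossing-cuts : ∀ {i x z} → suc i < n → x < i → i < z → z ≤ N → x ~ z →
        (∀ {s} → x < s → s ≤ i → ¬ NeighbourBeyond i s) → ⊥
      lastCrossing-cuts {i} {x} {z} i+1<n x<i i<z z≤N x~z last =
        ¬separatedBy Q (<-trans x<i i<n) i<n i+1<n (>⇒≢ x<i) (>⇒≢ (<-trans x<i (n<1+n i)))
          (x<i , ≤-refl) (λ (_ , i+1≤i) → 1+n≰n i+1≤i) closed
        where
        i<n : i < n
        i<n = <-trans (n<1+n i) i+1<n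
        Q : ℕ → Set
        Q s = x < s × s ≤ i
        closed : ∀ {s t} → Q s → t < n → s ~ t → t ≢ x → Q t
        closed {s} {t} (x<s , s≤i) t<n s~t t≢x with <-cmp t x
        ... | tri< t<x _ _ = ⊥-elim (noCrossing (t<x , x<s , ≤-<-trans s≤i i<z) (s≤s z≤N) (~-sym s~t) x~z)
        ... | tri≈ _ t≡x _ = ⊥-elim (t≢x t≡x)
        ... | tri> _ _ x<t with t ≤? i
        ...   | yes t≤i = x<t , t≤i
        ...   | no  t≰i = ⊥-elim (last x<s s≤i (t , ≰⇒> t≰i , ≤-pred t<n , s~t))

      firstBeyond-cuts : ∀ {i z} → suc i < z → z < n → i ~ z → (∀ {s} → i < s → s < z → ¬ i ~ s) → ⊥
      firstBeyond-cuts {i} {z} i+1<z z<n i~z first =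
        ¬separatedBy Q z<n (<-trans i+1<z z<n) (<-trans (n<1+n i) (<-trans i+1<z z<n))
          (<⇒≢ i+1<z) (<⇒≢ (<-trans (n<1+n i) i+1<z)) (≤-refl , i+1<z) (λ (i<i , _) → <-irrefl refl i<i) closed
        where
        Q : ℕ → Set
        Q s = i < s × s < z
        closed : ∀ {s t} → Q s → t < n → s ~ t → t ≢ z → Q t
        closed {s} {t} (i<s , s<z) t<n s~t t≢z with <-cmp t i
        ... | tri< t<i _ _    = ⊥-elim (noCrossing (t<i , i<s , s<z) z<n (~-sym s~t) i~z)
        ... | tri≈ _ refl _   = ⊥-elim (first i<s s<z (~-sym s~t))
        ... | tri> _ _ i<t with <-cmp t z
        ...   | tri< t<z _ _  = i<t , t<z
        ...   | tri≈ _ t≡z _  = ⊥-elim (t≢z t≡z)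
        ...   | tri> _ _ z<t  = ⊥-elim (noCrossing (i<s , s<z , z<t) t<n i~z s~t)

    -- If i ≁ i + 1, then the last x ≤ i with a neighbour beyond i, or else the
    -- first neighbour of i beyond i + 1, is a cut vertex.
    boundary-edge : ∀ {i} → suc i < n → i ~ suc i
    boundary-edge {i} i+1<n with greatest? (neighbourBeyond? i) 0 i
    ... | inj₂ none = ⊥-elim (¬separated (_≤ i) (<-trans (n<1+n i) i+1<n) i+1<n ≤-refl 1+n≰n closed)
      where
      closed : ∀ {s t} → s ≤ i → t < n → s ~ t → t ≤ i
      closed {s} {t} s≤i t<n s~t with t ≤? i
      ... | yes t≤i = t≤i
      ... | no  t≰i = ⊥-elim (none z≤n s≤i (t , ≰⇒> t≰i , ≤-pred t<n , s~t))
    ... | inj₁ (greatest x _ x≤i (z , i<z , z≤N , x~z) last) with m≤n⇒m<n∨m≡n x≤i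
    ...   | inj₁ x<i = ⊥-elim (lastCrossing-cuts i+1<n x<i i<z z≤N x~z last)
    ...   | inj₂ refl with least? (i ~?_) (suc i) N
    ...     | inj₂ none = ⊥-elim (none i<z z≤N x~z)
    ...     | inj₁ (least z′ i<z′ z′≤N i~z′ first) with m≤n⇒m<n∨m≡n i<z′
    ...       | inj₂ refl    = i~z′
    ...       | inj₁ i+1<z′ = ⊥-elim (firstBeyond-cuts i+1<z′ (s≤s z′≤N) i~z′ first)

    closing-edge : 1 ≤ N → 0 ~ N
    closing-edge 1≤N with greatest? (0 ~?_) 1 N
    ... | inj₂ none = ⊥-elim (¬separated (_≡ 0) (s≤s z≤n) (s≤s 1≤N) refl (λ ()) closed)
      where
      closed : ∀ {s t} → s ≡ 0 → t < n → s ~ t → t ≡ 0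
      closed {t = zero}  refl _   _   = refl
      closed {t = suc t} refl t<n 0~t = ⊥-elim (none (s≤s z≤n) (≤-pred t<n) 0~t)
    ... | inj₁ (greatest y 1≤y y≤N 0~y last) with m≤n⇒m<n∨m≡n y≤N
    ...   | inj₂ refl = 0~y
    ...   | inj₁ y<N  = ⊥-elim (¬separatedBy Q (s≤s y≤N) ≤-refl (s≤s z≤n) (>⇒≢ y<N) (<⇒≢ 1≤y)
                          (y<N , ≤-refl) (λ ()) closed)
      where
      Q : ℕ → Set
      Q s = y < s × s ≤ N
      closed : ∀ {s t} → Q s → t < n → s ~ t → t ≢ y → Q t
      closed {s} {t} (y<s , s≤N) t<n s~t t≢y with <-cmp t y
      ... | tri≈ _ t≡y _ = ⊥-elim (t≢y t≡y)
      ... | tri> _ _ y<t = y<t , ≤-pred t<n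
      closed {s} {zero}  (y<s , s≤N) t<n s~t t≢y | tri< _ _ _ = ⊥-elim (last y<s s≤N (~-sym s~t))
      closed {s} {suc t} (y<s , s≤N) t<n s~t t≢y | tri< t<y _ _ =
        ⊥-elim (noCrossing (s≤s z≤n , t<y , y<s) (s≤s s≤N) 0~y (~-sym s~t))

module Regions {N : ℕ} {G : Graph (suc N)} {v : Fin (suc N)} (L : Layout G v) (2-connected : TwoConnected G) where
  open Positions L
  open OuterCycle 2-connected using (boundary-edge; closing-edge)

  Within : ℕ → ℕ → List (Fin n) → Set
  Within c d = All (λ y → c ≤ pos y × pos y ≤ d)

  within-weaken : ∀ {c d c′ d′ xs} → c′ ≤ c → d ≤ d′ → Within c d xs → Within c′ d′ xs
  within-weaken c′≤c d≤d′ = All.map λ (c≤y , y≤d) → ≤-trans c′≤c c≤y , ≤-trans y≤d d≤d′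

  within-map : ∀ {c d ts} → d < n → All (λ t → c ≤ t × t ≤ d) ts → Within c d (map π ts)
  within-map d<n bounds = Allₚ.map⁺ (All.map (λ {t} (c≤t , t≤d) →
    subst (λ s → _ ≤ s × s ≤ _) (sym (pos-π (≤-<-trans t≤d d<n))) (c≤t , t≤d)) bounds)

  v∈within⇒v≡π : ∀ {c d xs} → Within c d xs → v ∈ xs → v ≡ π c
  v∈within⇒v≡π within v∈xs with n≤0⇒n≡0 (subst (_ ≤_) pos-v (proj₁ (All.lookup within v∈xs)))
  ... | refl = trans (sym (π-pos v)) (cong π pos-v)

  v∉within : ∀ {c d xs} → 0 < c → Within c d xs → v ∉ xs
  v∉within 0<c within v∈xs = <⇒≱ 0<c (subst (_ ≤_) pos-v (proj₁ (All.lookup within v∈xs)))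

  EarOver : ℕ → ℕ → Set
  EarOver c d = Σ (Ear G) λ H → Ear.first H ≡ π c × Ear.last H ≡ π d × Within c d (earVerts G H)

  ChainOver : ℕ → ℕ → Set
  ChainOver c d = Σ (EarChain G) λ H → EarChain.first H ≡ π c × EarChain.last H ≡ π d × Within c d (chainVerts G H)

  good-ear-last : ∀ {c d} → EarOver c d → deg G (π d) ≡ 3 → GoodStructure G v
  good-ear-last (H , first , last , within) d≡3 =
    inj₁ (H , inj₂ (subst (λ x → deg G x ≡ 3) (sym last) d≡3 , λ v∈H → trans (v∈within⇒v≡π within v∈H) (sym first)))

  good-ear-first : ∀ {c d} → 0 < c → EarOver c d → deg G (π c) ≡ 3 → GoodStructure G v
  good-ear-first 0<c (H , first , _ , within) c≡3 =
    inj₁ (H , inj₁ (subst (λ x → deg G x ≡ 3) (sym first) c≡3 , λ v∈H → ⊥-elim (v∉within 0<c within v∈H)))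

  good-chain-last : ∀ {c d} → ChainOver c d → deg G (π d) ≤ 5 → GoodStructure G v
  good-chain-last (H , first , last , within) d≤5 =
    inj₂ (inj₁ (H , inj₂ (subst (λ x → deg G x ≤ 5) (sym last) d≤5 , λ v∈H → trans (v∈within⇒v≡π within v∈H) (sym first))))

  good-chain-first : ∀ {c d} → 0 < c → ChainOver c d → deg G (π c) ≤ 5 → GoodStructure G v
  good-chain-first 0<c (H , first , _ , within) c≤5 =
    inj₂ (inj₁ (H , inj₁ (subst (λ x → deg G x ≤ 5) (sym first) c≤5 , λ v∈H → ⊥-elim (v∉within 0<c within v∈H))))

  data Shape : Set where
    edge ear chain : Shape

  _≟ˢ_ : (K K′ : Shape) → Dec (K ≡ K′)
  edge  ≟ˢ edge  = yes refl
  ear   ≟ˢ ear   = yes refl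
  chain ≟ˢ chain = yes refl
  edge  ≟ˢ ear   = no λ ()
  edge  ≟ˢ chain = no λ ()
  ear   ≟ˢ edge  = no λ ()
  ear   ≟ˢ chain = no λ ()
  chain ≟ˢ edge  = no λ ()
  chain ≟ˢ ear   = no λ ()

  rootDegree : Shape → ℕ
  rootDegree edge  = 1
  rootDegree ear   = 2
  rootDegree chain = 3

  -- The chain case also records an ear hanging at d: it is the good ear when
  -- the whole graph turns out to be a chain-shaped region.
  Shaped : Shape → ℕ → ℕ → Set
  Shaped edge  c d = suc c ≡ d
  Shaped ear   c d = EarOver c d × (∀ {t} → c < t → t < d → deg G (π t) ≡ 2)
  Shaped chain c d = ChainOver c d × Σ ℕ λ q → c < q × q < d × EarOver q d

  -- The part of G on positions c … d, cut off by the edge cd, is an edge, an ear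
  -- or an ear chain with root edge cd.
  record Region (K : Shape) (c d : ℕ) : Set where
    field
      leftDegree  : neighbours c (suc c) (suc d) ≡ rootDegree K
      rightDegree : neighbours d c d ≡ rootDegree K
      shaped      : Shaped K c d
  open Region

  Classified : ℕ → ℕ → Set
  Classified c d = GoodStructure G v ⊎ Σ Shape λ K → Region K c d

  -- x has degree 3, 4 or 5, so the ear or chain on one side of x is good at its end x.
  shape-mismatch : ∀ {p x y} K K′ → 0 < x → K ≢ K′ → Shaped K p x → Shaped K′ x y →
    deg G (π x) ≡ rootDegree K + rootDegree K′ → GoodStructure G v
  shape-mismatch edge  edge  _   K≢K′ _ _ _ = ⊥-elim (K≢K′ refl)
  shape-mismatch ear   ear   _   K≢K′ _ _ _ = ⊥-elim (K≢K′ refl)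
  shape-mismatch chain chain _   K≢K′ _ _ _ = ⊥-elim (K≢K′ refl)
  shape-mismatch edge  ear   0<x _ _ (H , _) x≡3 = good-ear-first 0<x H x≡3
  shape-mismatch ear   edge  _   _ (H , _) _ x≡3 = good-ear-last H x≡3
  shape-mismatch edge  chain 0<x _ _ (H , _) x≡4 = good-chain-first 0<x H (m≤n⇒m≤1+n (≤-reflexive x≡4))
  shape-mismatch ear   chain 0<x _ _ (H , _) x≡5 = good-chain-first 0<x H (≤-reflexive x≡5)
  shape-mismatch chain edge  _   _ (H , _) _ x≡4 = good-chain-last H (m≤n⇒m≤1+n (≤-reflexive x≡4))
  shape-mismatch chain ear   _   _ (H , _) _ x≡5 = good-chain-last H (≤-reflexive x≡5)

  π-unique : ∀ {ts} → AllPairs _<_ ts → All (_< n) ts → Unique (map π ts)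
  π-unique []               []            = []
  π-unique (t<ts ∷ ascending) (t<n ∷ ts<n) =
    Allₚ.map⁺ (All.zipWith (λ (t<s , s<n) πt≡πs → <⇒≢ t<s (π-injective t<n s<n πt≡πs)) (t<ts , ts<n))
    ∷ π-unique ascending ts<n

  map-π-cycle : ∀ c ps d → map π (c ∷ ps ++ [ d ]) ≡ π c ∷ map π ps ++ [ π d ]
  map-π-cycle c ps d = cong (π c ∷_) (Listₚ.map-++ π ps [ d ])

  within-cycle : ∀ {c d} ps → d < n → Linked _<_ (c ∷ ps ++ [ d ]) → Within c d (π c ∷ map π ps ++ [ π d ])
  within-cycle {c} {d} ps d<n ascending =
    subst (Within c d) (map-π-cycle c ps d) (within-map d<n (Linked<⇒bounded ps ascending))

  cycleThrough : ∀ {c d} ps → d < n → 1 ≤ length ps → Linked _<_ (c ∷ ps ++ [ d ]) →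
    Linked _~_ (c ∷ ps ++ [ d ]) → d ~ c → CycleThrough G (π c) (map π ps) (π d)
  cycleThrough {c} {d} ps d<n nonempty ascending path d~c =
    subst (1 ≤_) (sym (Listₚ.length-map π ps)) nonempty ,
    subst Unique (map-π-cycle c ps d)
      (π-unique (Linkedₚ.Linked⇒AllPairs <-trans ascending)
                (All.map (λ (_ , t≤d) → ≤-<-trans t≤d d<n) (Linked<⇒bounded ps ascending))) ,
    subst (Linked (E G)) (map-π-cycle c ps d) (Linkedₚ.map⁺ path) ,
    d~c

  -- Walking the face of G inside the edge ab from a to b.
  module Face {a b w : ℕ} (a+1<b : suc a < b) (b<n : b < n) (a~b : a ~ b) (b≤a+1+w : b ≤ a + suc w)
    (classify : ∀ {c d} → c < d → d ≤ c + w → d < n → c ~ d → Classified c d) where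

    a<b : a < b
    a<b = <-trans (n<1+n a) a+1<b

    Shielded : ℕ → Set
    Shielded u = ∀ {t s} → a ≤ t → t < u → u < s → s ≤ b → t ~ s → t ≡ a × s ≡ b

    -- y follows cur on the face.
    record FaceStep (cur y : ℕ) : Set where
      field
        cur<y    : cur < y
        y≤b      : y ≤ b
        cur~y    : cur ~ y
        from-a   : cur ≡ a → y < b
        farthest : ∀ {s} → y < s → s ≤ b → cur ~ s → cur ≡ a × s ≡ b
    open FaceStep

    faceStep : ∀ {cur} → cur < b → Σ ℕ (FaceStep cur)
    faceStep {cur} cur<b with greatest? P? (suc cur) b
      where
      P : ℕ → Set
      P t = cur ~ t × (cur ≡ a → t < b)
      P? : ∀ t → Dec (P t)
      P? t = (cur ~? t) ×-dec ((cur ≟ a) →-dec (t <? b))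
    ... | inj₂ none = ⊥-elim (none ≤-refl cur<b (boundary-edge (≤-<-trans cur<b b<n) , λ { refl → a+1<b }))
    ... | inj₁ (greatest y cur<y y≤b (cur~y , from-a) last) = y , record
      { cur<y = cur<y ; y≤b = y≤b ; cur~y = cur~y ; from-a = from-a ; farthest = farthest′ }
      where
      farthest′ : ∀ {s} → y < s → s ≤ b → cur ~ s → cur ≡ a × s ≡ b
      farthest′ {s} y<s s≤b cur~s with cur ≟ a | s <? b
      ... | no  cur≢a | _       = ⊥-elim (last y<s s≤b (cur~s , λ cur≡a → ⊥-elim (cur≢a cur≡a)))
      ... | yes cur≡a | yes s<b = ⊥-elim (last y<s s≤b (cur~s , λ _ → s<b))
      ... | yes cur≡a | no  s≮b = cur≡a , ≤-antisym s≤b (≮⇒≥ s≮b)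

    shielded-a : Shielded a
    shielded-a a≤t t<a = ⊥-elim (<⇒≱ t<a a≤t)

    shielded-step : ∀ {cur y} → Shielded cur → FaceStep cur y → Shielded y
    shielded-step {cur} shielded next {t} a≤t t<y y<s s≤b t~s with <-cmp t cur
    ... | tri< t<cur _ _ = shielded a≤t t<cur (<-trans (cur<y next) y<s) s≤b t~s
    ... | tri≈ _ refl _  = farthest next y<s s≤b t~s
    ... | tri> _ _ cur<t = ⊥-elim (noCrossing (cur<t , t<y , y<s) (≤-<-trans s≤b b<n) (cur~y next) t~s)

    step-width : ∀ {cur y} → a ≤ cur → FaceStep cur y → y ≤ cur + w
    step-width {cur} {y} a≤cur next with cur ≟ a
    ... | yes refl = ≤-pred (subst (suc y ≤_) (+-suc cur w) (<-≤-trans (from-a next refl) b≤a+1+w))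
    ... | no  cur≢a = ≤-trans (y≤b next) (≤-trans b≤a+1+w
                        (subst (_≤ cur + w) (sym (+-suc a w)) (+-monoˡ-≤ w (≤∧≢⇒< a≤cur (≢-sym cur≢a)))))

    deg-junction : ∀ {p cur y K K′} → a ≤ p → p < cur → cur < b → Shielded p → FaceStep cur y →
      Region K p cur → Region K′ cur y → deg G (π cur) ≡ rootDegree K + rootDegree K′
    deg-junction {p} {cur} {y} a≤p p<cur cur<b shielded next R R′ =
      trans (deg-within (<⇒≤ p<cur) (cur<y next) (≤-<-trans (y≤b next) b<n) below above)
            (cong₂ _+_ (rightDegree R) (leftDegree R′))
      where
      a<cur : a < cur
      a<cur = ≤-<-trans a≤p p<cur
      below : ∀ {t} → t < p → ¬ cur ~ t
      below {t} t<p cur~t with t <? a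
      ... | yes t<a = noCrossing (t<a , a<cur , cur<b) b<n (~-sym cur~t) a~b
      ... | no  t≮a = <-irrefl (proj₂ (shielded (≮⇒≥ t≮a) t<p p<cur (<⇒≤ cur<b) (~-sym cur~t))) cur<b
      above : ∀ {t} → y < t → t < n → ¬ cur ~ t
      above {t} y<t t<n cur~t with t ≤? b
      ... | yes t≤b = <-irrefl (sym (proj₁ (farthest next y<t t≤b cur~t))) a<cur
      ... | no  t≰b = noCrossing (a<cur , cur<b , ≰⇒> t≰b) t<n a~b cur~t

    Children : Shape → List ℕ → ℕ → Set
    Children edge  ps lo = ⊤
    Children ear   ps lo = Σ (List (Ear G)) λ Hs →
      Links G Ear.first Ear.last (map π ps) Hs × Within lo b (concatMap (earVerts G) Hs)
    Children chain ps lo = Σ (List (EarChain G)) λ Hs →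
      Links G EarChain.first EarChain.last (map π ps) Hs × Within lo b (concatMap (chainVerts G) Hs)

    children-∷ : ∀ K {cur y ps} → cur ≤ y → y ≤ b → Shaped K cur y → Children K (y ∷ ps) y → Children K (cur ∷ y ∷ ps) cur
    children-∷ edge  _     _   _ _ = tt
    children-∷ ear   cur≤y y≤b ((H , first , last , inH) , _) (Hs , links , inHs) =
      H ∷ Hs , (first , last , links) , Allₚ.++⁺ (within-weaken ≤-refl y≤b inH) (within-weaken cur≤y ≤-refl inHs)
    children-∷ chain cur≤y y≤b ((H , first , last , inH) , _) (Hs , links , inHs) =
      H ∷ Hs , (first , last , links) , Allₚ.++⁺ (within-weaken ≤-refl y≤b inH) (within-weaken cur≤y ≤-refl inHs)

    children-[] : ∀ K {cur} → Shaped K cur b → Children K (cur ∷ b ∷ []) cur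
    children-[] edge  _ = tt
    children-[] ear   ((H , first , last , inH) , _) = H ∷ [] , (first , last , tt) , Allₚ.++⁺ inH []
    children-[] chain ((H , first , last , inH) , _) = H ∷ [] , (first , last , tt) , Allₚ.++⁺ inH []

    -- The rest of the face from cur on, all of whose regions have shape K.
    record FaceSuffix (K : Shape) (cur : ℕ) : Set where
      field
        inner         : List ℕ
        ascending     : Linked _<_ (cur ∷ inner ++ [ b ])
        path          : Linked _~_ (cur ∷ inner ++ [ b ])
        degrees       : All (λ t → deg G (π t) ≡ rootDegree K + rootDegree K) (cur ∷ inner)
        children      : Children K (cur ∷ inner ++ [ b ]) cur
        last          : ℕ
        cur≤last      : cur ≤ last
        last<b        : last < b
        last-shielded : Shielded last
        last-region   : Region K last b
        edge-degrees  : K ≡ edge → ∀ {t} → cur ≤ t → t < b → deg G (π t) ≡ 2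
    open FaceSuffix

    suffix-end : ∀ {K cur} → cur < b → cur ~ b → Shielded cur →
      deg G (π cur) ≡ rootDegree K + rootDegree K → Region K cur b → FaceSuffix K cur
    suffix-end {K} {cur} cur<b cur~b shielded deg≡ R = record
      { inner = [] ; ascending = cur<b ∷ [-] ; path = cur~b ∷ [-] ; degrees = deg≡ ∷ []
      ; children = children-[] K (shaped R)
      ; last = cur ; cur≤last = ≤-refl ; last<b = cur<b ; last-shielded = shielded ; last-region = R
      ; edge-degrees = edge-degrees′ }
      where
      edge-degrees′ : K ≡ edge → ∀ {t} → cur ≤ t → t < b → deg G (π t) ≡ 2
      edge-degrees′ refl cur≤t t<b with shaped R
      ... | refl with ≤-antisym cur≤t (≤-pred t<b)
      ...   | refl = deg≡

    suffix-∷ : ∀ {K cur y} → cur < y → y ≤ b → cur ~ y →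
      deg G (π cur) ≡ rootDegree K + rootDegree K → Region K cur y → FaceSuffix K y → FaceSuffix K cur
    suffix-∷ {K} {cur} {y} cur<y y≤b cur~y deg≡ R S = record
      { inner = y ∷ inner S ; ascending = cur<y ∷ ascending S ; path = cur~y ∷ path S
      ; degrees = deg≡ ∷ degrees S
      ; children = children-∷ K (<⇒≤ cur<y) y≤b (shaped R) (children S)
      ; last = last S ; cur≤last = ≤-trans (<⇒≤ cur<y) (cur≤last S) ; last<b = last<b S
      ; last-shielded = last-shielded S ; last-region = last-region S
      ; edge-degrees = edge-degrees′ }
      where
      edge-degrees′ : K ≡ edge → ∀ {t} → cur ≤ t → t < b → deg G (π t) ≡ 2
      edge-degrees′ refl cur≤t t<b with shaped R | m≤n⇒m<n∨m≡n cur≤t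
      ... | refl | inj₂ refl = deg≡
      ... | refl | inj₁ cur<t = edge-degrees S refl cur<t t<b

    faceSuffix : ∀ k {K p cur} → b ≤ cur + k → a ≤ p → Shielded p → FaceStep p cur → cur < b →
      Region K p cur → GoodStructure G v ⊎ FaceSuffix K cur
    faceSuffix zero    {cur = cur} b≤cur _ _ _ cur<b _ = ⊥-elim (<⇒≱ cur<b (subst (b ≤_) (+-identityʳ cur) b≤cur))
    faceSuffix (suc k) {K} {p} {cur} b≤cur+1+k a≤p shielded-p arrival cur<b R with faceStep cur<b
    ... | y , next with classify (cur<y next) (step-width (<⇒≤ (≤-<-trans a≤p (cur<y arrival))) next) (≤-<-trans (y≤b next) b<n) (cur~y next)
    ...   | inj₁ good      = inj₁ good
    ...   | inj₂ (K′ , R′) = continue (K ≟ˢ K′) R′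
      where
      a≤cur : a ≤ cur
      a≤cur = <⇒≤ (≤-<-trans a≤p (cur<y arrival))

      junction : ∀ {K′} → Region K′ cur y → deg G (π cur) ≡ rootDegree K + rootDegree K′
      junction = deg-junction a≤p (cur<y arrival) cur<b shielded-p next R

      b≤y+k : b ≤ y + k
      b≤y+k = ≤-trans b≤cur+1+k (≤-trans (≤-reflexive (+-suc cur k)) (+-monoˡ-≤ k (cur<y next)))

      continue : ∀ {K′} → Dec (K ≡ K′) → Region K′ cur y → GoodStructure G v ⊎ FaceSuffix K cur
      continue (no K≢K′) R′ =
        inj₁ (shape-mismatch K _ (≤-<-trans z≤n (cur<y arrival)) K≢K′ (shaped R) (shaped R′) (junction R′))
      continue (yes refl) R′ with y ≟ b
      ... | yes refl = inj₂ (suffix-end cur<b (cur~y next) (shielded-step shielded-p arrival) (junction R′) R′)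
      ... | no  y≢b  = map₂ (suffix-∷ (cur<y next) (y≤b next) (cur~y next) (junction R′) R′)
                         (faceSuffix k b≤y+k a≤cur (shielded-step shielded-p arrival) next (≤∧≢⇒< (y≤b next) y≢b) R′)

    left-enclosed : ∀ {K p₁} → FaceStep a p₁ → Region K a p₁ → neighbours a (suc a) (suc b) ≡ rootDegree K + 1
    left-enclosed {K} {p₁} first R₁ = begin
      neighbours a (suc a) (suc b)
        ≡⟨ neighbours-split a (s≤s (<⇒≤ (cur<y first))) (s≤s (<⇒≤ p₁<b)) ⟩
      neighbours a (suc a) (suc p₁) + neighbours a (suc p₁) (suc b)
        ≡⟨ cong (neighbours a (suc a) (suc p₁) +_) (neighbours-split a p₁<b (n≤1+n b)) ⟩
      neighbours a (suc a) (suc p₁) + (neighbours a (suc p₁) b + neighbours a b (suc b))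
        ≡⟨ cong₂ (λ l m → l + (m + neighbours a b (suc b))) (leftDegree R₁) (neighbours-none a p₁<b gap) ⟩
      rootDegree K + neighbours a b (suc b)
        ≡⟨ cong (rootDegree K +_) (neighbours-single a~b) ⟩
      rootDegree K + 1 ∎
      where
      open ≡-Reasoning
      p₁<b : p₁ < b
      p₁<b = from-a first refl
      gap : ∀ {t} → suc p₁ ≤ t → t < b → ¬ a ~ t
      gap p₁<t t<b a~t = <-irrefl (proj₂ (farthest first p₁<t (<⇒≤ t<b) a~t)) t<b

    right-enclosed : ∀ {K p₁} → a < p₁ → FaceSuffix K p₁ → neighbours b a b ≡ 1 + rootDegree K
    right-enclosed {K} {p₁} a<p₁ S = begin
      neighbours b a b
        ≡⟨ neighbours-split b (n≤1+n a) a<b ⟩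
      neighbours b a (suc a) + neighbours b (suc a) b
        ≡⟨ cong (neighbours b a (suc a) +_) (neighbours-split b a<last (<⇒≤ (last<b S))) ⟩
      neighbours b a (suc a) + (neighbours b (suc a) (last S) + neighbours b (last S) b)
        ≡⟨ cong₂ (λ l m → l + (m + neighbours b (last S) b)) (neighbours-single (~-sym a~b)) (neighbours-none b a<last gap) ⟩
      1 + neighbours b (last S) b
        ≡⟨ cong (1 +_) (rightDegree (last-region S)) ⟩
      1 + rootDegree K ∎
      where
      open ≡-Reasoning
      a<last : a < last S
      a<last = <-≤-trans a<p₁ (cur≤last S)
      gap : ∀ {t} → suc a ≤ t → t < last S → ¬ b ~ t
      gap a<t t<last b~t = <-irrefl (sym (proj₁ (last-shielded S (<⇒≤ a<t) t<last (last<b S) ≤-refl (~-sym b~t)))) a<t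

    module Enclosure {K p₁} (first : FaceStep a p₁) (R₁ : Region K a p₁) (S : FaceSuffix K p₁) where
      a<p₁ : a < p₁
      a<p₁ = cur<y first

      face : List ℕ
      face = p₁ ∷ inner S

      cycle : CycleThrough G (π a) (map π face) (π b)
      cycle = cycleThrough face b<n (s≤s z≤n) (a<p₁ ∷ ascending S) (cur~y first ∷ path S) (~-sym a~b)

      face-degrees : All (λ x → deg G x ≡ rootDegree K + rootDegree K) (map π face)
      face-degrees = Allₚ.map⁺ (degrees S)

      face-children : Children K (a ∷ face ++ [ b ]) a
      face-children = children-∷ K (<⇒≤ a<p₁) (<⇒≤ (from-a first refl)) (shaped R₁) (children S)

      relink : ∀ {H : Set} {s t : H → Fin n} {Hs} → Links G s t (map π (a ∷ face ++ [ b ])) Hs →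
        Links G s t (π a ∷ map π face ++ [ π b ]) Hs
      relink {s = s} {t} {Hs} = subst (λ xs → Links G s t xs Hs) (map-π-cycle a face b)

    enclose : ∀ K {p₁} → FaceStep a p₁ → Region K a p₁ → FaceSuffix K p₁ → Classified a b
    enclose edge first R₁ S = inj₂ (ear , record
      { leftDegree = left-enclosed first R₁ ; rightDegree = right-enclosed a<p₁ S
      ; shaped = (H , refl , refl , within-cycle face b<n (a<p₁ ∷ ascending S)) , inner-degrees })
      where
      open Enclosure first R₁ S
      H : Ear G
      H = record { first = π a ; last = π b ; mid = map π face ; cycle = cycle ; deg2 = face-degrees }
      inner-degrees : ∀ {t} → a < t → t < b → deg G (π t) ≡ 2
      inner-degrees a<t t<b = edge-degrees S refl (subst (_≤ _) (shaped R₁) a<t) t<b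
    enclose ear first R₁ S with Enclosure.face-children first R₁ S
    ... | Hs , links , inHs = inj₂ (chain , record
      { leftDegree = left-enclosed first R₁ ; rightDegree = right-enclosed a<p₁ S
      ; shaped = (H , refl , refl , inHs)
               , last S , <-≤-trans a<p₁ (cur≤last S) , last<b S , proj₁ (shaped (last-region S)) })
      where
      open Enclosure first R₁ S
      H : EarChain G
      H = record { first = π a ; last = π b ; inner = map π face ; cycle = cycle ; deg4 = face-degrees
                 ; ears = Hs ; links = relink links }
    enclose chain first R₁ S with Enclosure.face-children first R₁ S
    ... | Hs , links , inHs = inj₁ (inj₂ (inj₂ (H , λ v∈H → inj₁ (v∈within⇒v≡π inHs v∈H))))
      where
      open Enclosure first R₁ S
      H : EarDoubleChain G
      H = record { first = π a ; last = π b ; inner = map π face ; cycle = cycle ; deg6 = face-degrees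
                 ; chains = Hs ; links = relink links }

    faceRegion : Classified a b
    faceRegion with faceStep a<b
    ... | p₁ , first with classify (cur<y first) (step-width ≤-refl first) (≤-<-trans (y≤b first) b<n) (cur~y first)
    ...   | inj₁ good    = inj₁ good
    ...   | inj₂ (K , R₁) with faceSuffix b (m≤n+m b p₁) ≤-refl shielded-a first (from-a first refl) R₁
    ...     | inj₁ good = inj₁ good
    ...     | inj₂ S    = enclose K first R₁ S

  classify : ∀ w {c d} → c < d → d ≤ c + w → d < n → c ~ d → Classified c d
  classify zero    {c} {d} c<d d≤c         _   _   = ⊥-elim (<⇒≱ c<d (subst (d ≤_) (+-identityʳ c) d≤c))
  classify (suc w) {c} {d} c<d d≤c+1+w d<n c~d with suc c ≟ d
  ... | yes refl = inj₂ (edge , record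
    { leftDegree = neighbours-single c~d ; rightDegree = neighbours-single (~-sym c~d) ; shaped = refl })
  ... | no  c+1≢d = Face.faceRegion (≤∧≢⇒< c<d c+1≢d) d<n c~d d≤c+1+w (classify w)

  deg-first : deg G (π 0) ≡ neighbours 0 1 n
  deg-first = trans (deg≡neighbours 0) (trans (neighbours-split 0 {hi = n} z≤n (s≤s z≤n))
    (cong (_+ neighbours 0 1 n) (neighbours-self 0)))

  deg-last : deg G (π N) ≡ neighbours N 0 N
  deg-last = trans (deg≡neighbours N) (trans (neighbours-split N z≤n (n≤1+n N))
    (trans (cong (neighbours N 0 N +_) (neighbours-self N)) (+-identityʳ _)))

  goodStructure : 3 ≤ N → ¬ IsCycleGraph G → GoodStructure G v
  goodStructure 3≤N ¬cycle with classify n 0<N (n≤1+n N) ≤-refl (closing-edge (≤-trans (s≤s z≤n) 3≤N))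
    where
    0<N : 0 < N
    0<N = <-≤-trans (s≤s z≤n) 3≤N
  ... | inj₁ good = good
  ... | inj₂ (edge  , R) = ⊥-elim (<⇒≢ (<-≤-trans (s≤s (s≤s z≤n)) 3≤N) (shaped R))
  ... | inj₂ (ear   , R) = ⊥-elim (¬cycle (proj₁ (proj₂ 2-connected) , λ x → subst (λ y → deg G y ≡ 2) (π-pos x) (deg≡2 (pos<n x))))
    where
    deg≡2 : ∀ {t} → t < n → deg G (π t) ≡ 2
    deg≡2 {zero}  _   = trans deg-first (leftDegree R)
    deg≡2 {suc t} t<n with suc t ≟ N
    ... | yes refl = trans deg-last (rightDegree R)
    ... | no  t≢N  = proj₂ (shaped R) (s≤s z≤n) (≤∧≢⇒< (≤-pred t<n) t≢N)
  ... | inj₂ (chain , R) with shaped R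
  ...   | _ , _ , _ , _ , H = good-ear-last H (trans deg-last (rightDegree R))

lemma3p1 : {n : ℕ} (G : Graph n) (v : Fin n) →
    4 ≤ n → TwoConnected G → Outerplanar G → ¬ IsCycleGraph G →
    Σ (Ear G) (GoodEar G v)
    ⊎ Σ (EarChain G) (GoodChain G v)
    ⊎ Σ (EarDoubleChain G) (GoodDouble G v)
lemma3p1 {suc N} G v (s≤s 3≤N) 2-connected outerplanar ¬cycle =
  Regions.goodStructure (outerplanar⇒layout G outerplanar v) 2-connected 3≤N ¬cycle
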